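{- Let $d\ge2$ be an integer, let $s_d(n)$ be the sum of the base-$d$ digits of $n$, let $t_d(n)=\overline{(s_d(n))}_d$, and for $j\in\{0,\ldots,d-1\}$ let $(a_{j,d}(n))_{n\ge0}$ be the increasing enumeration (indexed from $0$) of the nonnegative integers $k$ with $t_d(k)=j$. Then for every integer $N\ge0$, $$\sum_{k=0}^{N}a_{j,d}(k)=\frac{dN(N+1)}{2}+\frac{\lfloor N/d\rfloor\, d(d-1)}{2}+\overline{(j-t_d(\lfloor N/d\rfloor))}_d\,\big(\overline{(N)}_d+1\big)-\frac{\overline{(N)}_d\big(\overline{(N)}_d+1\big)}{2}+d\max\Big\{\overline{(N)}_d-\overline{(j-t_d(\lfloor N/d\rfloor))}_d,\,0\Big\}.$$
   Context: For an integer $x$, $\overline{(x)}_d$ denotes the residue of $x$ modulo $d$, i.e. the unique integer in $[0,d-1]$ congruent to $x$ modulo $d$. -}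

module Defs where

open import Data.Nat using (ℕ; zero; suc; _+_; _*_; _∸_; _<_; NonZero)
open import Data.Nat.DivMod using (_/_; _%_)
open import Data.Integer using (ℤ; +_; _-_; _%ℕ_)
open import Data.Product using (_×_; ∃-syntax)
open import Relation.Binary.PropositionalEquality using (_≡_)

-- Sum of base-d digits of n, computed with fuel (fuel ≥ number of digits suffices;
-- fuel = n is always enough since each step with n > 0 strictly decreases n when d ≥ 2).
digitSumFuel : (d : ℕ) .{{_ : NonZero d}} → ℕ → ℕ → ℕ
digitSumFuel d zero    n = 0
digitSumFuel d (suc f) n = n % d + digitSumFuel d f (n / d)

s : (d : ℕ) .{{_ : NonZero d}} → ℕ → ℕ
s d n = digitSumFuel d n n

t : (d : ℕ) .{{_ : NonZero d}} → ℕ → ℕ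
t d n = s d n % d

res : (d : ℕ) .{{_ : NonZero d}} → ℤ → ℕ
res d x = x %ℕ d

IsIncreasingEnumeration : (ℕ → Set) → (ℕ → ℕ) → Set
IsIncreasingEnumeration P a =
  (∀ m n → m < n → a m < a n) ×
  (∀ n → P (a n)) ×
  (∀ k → P k → ∃[ n ] a n ≡ k)

sumTo : (ℕ → ℕ) → ℕ → ℕ
sumTo f zero    = f 0
sumTo f (suc N) = sumTo f N + f (suc N)

{-# OPTIONS --safe #-}
-- Appending a digit i < d to m adds i to the digit sum, so the numbers k with t_d(k) = j are
-- exactly m·d + c(m), where c(m) < d is the digit with c(m) + s_d(m) ≡ j (mod d); these grow
-- with m, so they form the enumeration a_{j,d} and Σ_{m≤N} a(m) = d·N(N+1)/2 + Σ_{m≤N} c(m).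
-- Since c(q'd + i) ≡ c(q') − i (mod d), the last digits of each complete block of d indices run
-- through all residues and contribute d(d−1)/2, while the final partial block 0 ≤ i ≤ r
-- contributes Σ_{i≤r} ((e − i) mod d) = e(r+1) − r(r+1)/2 + d·max(r − e, 0), with e = c(⌊N/d⌋).
module Submission where

open import Defs
open import Data.Nat using (ℕ; zero; suc; _+_; _*_; _∸_; _<_; _≤_; z≤n; s≤s; NonZero)
open import Data.Nat.Properties
open import Data.Nat.DivMod
open import Data.Nat.Divisibility using (divides-refl)
open import Data.Nat.Induction using (<-rec)
open import Algebra.Properties.CommutativeSemigroup +-commutativeSemigroup
  using (interchange; xy∙z≈xz∙y)
open import Data.Nat.Tactic.RingSolver using (solve; solve-∀)
open import Data.Integer as ℤ using (ℤ; +_; -[1+_]; _-_) renaming (_+_ to _+ℤ_)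
open import Data.Integer.DivMod using (a≡a%ℕn+[a/ℕn]*n; n%ℕd<d)
import Data.Integer.Properties as ℤ
import Data.Integer.Tactic.RingSolver as ℤ-Solver
open import Data.List using (_∷_; [])
open import Data.Product using (_,_; ∃-syntax)
open import Data.Sum using (inj₁; inj₂)
open import Relation.Nullary using (yes; no; contradiction)
open import Relation.Binary.PropositionalEquality

sumTo-cong-≤ : ∀ {f g} N → (∀ i → i ≤ N → f i ≡ g i) → sumTo f N ≡ sumTo g N
sumTo-cong-≤ zero    f≗g = f≗g 0 z≤n
sumTo-cong-≤ (suc N) f≗g =
  cong₂ _+_ (sumTo-cong-≤ N λ i i≤N → f≗g i (m≤n⇒m≤1+n i≤N)) (f≗g (suc N) ≤-refl)

sumTo-+ : ∀ f g N → sumTo (λ i → f i + g i) N ≡ sumTo f N + sumTo g N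
sumTo-+ f g zero    = refl
sumTo-+ f g (suc N) = begin
  sumTo (λ i → f i + g i) N + (f (suc N) + g (suc N))
    ≡⟨ cong (_+ (f (suc N) + g (suc N))) (sumTo-+ f g N) ⟩
  sumTo f N + sumTo g N + (f (suc N) + g (suc N))
    ≡⟨ interchange (sumTo f N) (sumTo g N) (f (suc N)) (g (suc N)) ⟩
  sumTo f N + f (suc N) + (sumTo g N + g (suc N))
    ∎
  where open ≡-Reasoning

sumTo-*ʳ : ∀ f c N → sumTo (λ i → f i * c) N ≡ sumTo f N * c
sumTo-*ʳ f c zero    = refl
sumTo-*ʳ f c (suc N) = trans (cong (_+ f (suc N) * c) (sumTo-*ʳ f c N))
                             (sym (*-distribʳ-+ c (sumTo f N) (f (suc N))))

sumTo-split : ∀ f m n → sumTo f (n + suc m) ≡ sumTo f m + sumTo (λ i → f (i + suc m)) n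
sumTo-split f m zero    = refl
sumTo-split f m (suc n) = trans (cong (_+ f (suc n + suc m)) (sumTo-split f m n))
                                (+-assoc (sumTo f m) _ _)

sumTo-blocks : ∀ n f c → (∀ p → sumTo (λ i → f (i + p * suc n)) n ≡ c) →
               ∀ q r → sumTo f (r + q * suc n) ≡ q * c + sumTo (λ i → f (i + q * suc n)) r
sumTo-blocks n f c block zero    r =
  trans (cong (sumTo f) (+-identityʳ r)) (sumTo-cong-≤ r λ i _ → cong f (sym (+-identityʳ i)))
sumTo-blocks n f c block (suc q) r = begin
  sumTo f (r + suc q * suc n)               ≡⟨ sumTo-split f (n + q * suc n) r ⟩
  sumTo f (n + q * suc n) + last            ≡⟨ cong (_+ last) (sumTo-blocks n f c block q n) ⟩
  q * c + sumTo (λ i → f (i + q * suc n)) n + last ≡⟨ cong (λ x → q * c + x + last) (block q) ⟩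
  q * c + c + last                          ≡⟨ cong (_+ last) (+-comm (q * c) c) ⟩
  suc q * c + last                          ∎
  where
    open ≡-Reasoning
    last : ℕ
    last = sumTo (λ i → f (i + suc q * suc n)) r

triangle : ℕ → ℕ
triangle = sumTo (λ i → i)

half-of : ∀ {m} n → m ≡ n * 2 → m / 2 ≡ n
half-of n refl = m*n/n≡m n 2

triangle-*2 : ∀ n → triangle n * 2 ≡ n * (n + 1)
triangle-*2 zero    = refl
triangle-*2 (suc n) = begin
  (triangle n + suc n) * 2     ≡⟨ *-distribʳ-+ 2 (triangle n) (suc n) ⟩
  triangle n * 2 + suc n * 2   ≡⟨ cong (_+ suc n * 2) (triangle-*2 n) ⟩
  n * (n + 1) + suc n * 2      ≡⟨ solve (n ∷ []) ⟩
  suc n * (suc n + 1)          ∎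
  where open ≡-Reasoning

StrictlyMonotone : (ℕ → ℕ) → Set
StrictlyMonotone a = ∀ m n → m < n → a m < a n

strictlyMonotone⇒monotone : ∀ {a} → StrictlyMonotone a → ∀ {m n} → m ≤ n → a m ≤ a n
strictlyMonotone⇒monotone {a} a-mono {m} {n} m≤n with m≤n⇒m<n∨m≡n m≤n
... | inj₁ m<n  = <⇒≤ (a-mono m n m<n)
... | inj₂ refl = ≤-refl

enumeration-≤ : ∀ {P a c} → IsIncreasingEnumeration P a → IsIncreasingEnumeration P c →
                ∀ n → (∀ {m} → m < n → a m ≡ c m) → a n ≤ c n
enumeration-≤ {a = a} {c} (a-mono , _ , a-covers) (c-mono , c-sat , _) n agree
  with a-covers (c n) (c-sat n)
... | m , am≡cn with m <? n
...   | yes m<n = contradiction (trans (sym (agree m<n)) am≡cn) (<⇒≢ (c-mono m n m<n))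
...   | no  m≮n = subst (a n ≤_) am≡cn (strictlyMonotone⇒monotone a-mono (≮⇒≥ m≮n))

enumeration-unique : ∀ {P a c} → IsIncreasingEnumeration P a → IsIncreasingEnumeration P c →
                     ∀ n → a n ≡ c n
enumeration-unique a-enum c-enum = <-rec _ λ n agree →
  ≤-antisym (enumeration-≤ a-enum c-enum n agree)
            (enumeration-≤ c-enum a-enum n λ m<n → sym (agree m<n))

module _ {D : ℕ} .{{_ : NonZero D}} where

  %-absorbˡ : ∀ m n → (m % D + n) % D ≡ (m + n) % D
  %-absorbˡ m n = begin
    (m % D + n) % D          ≡⟨ %-distribˡ-+ (m % D) n D ⟩
    (m % D % D + n % D) % D  ≡⟨ cong (λ x → (x + n % D) % D) (m%n%n≡m%n m D) ⟩
    (m % D + n % D) % D      ≡⟨ %-distribˡ-+ m n D ⟨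
    (m + n) % D              ∎
    where open ≡-Reasoning

  %-+-inverse : ∀ {x} u → x < D → ((x + u) % D + (D ∸ u % D)) % D ≡ x
  %-+-inverse {x} u x<D = begin
    ((x + u) % D + (D ∸ w)) % D          ≡⟨ %-absorbˡ (x + u) (D ∸ w) ⟩
    (x + u + (D ∸ w)) % D                ≡⟨ cong (λ v → (x + v + (D ∸ w)) % D) (m≡m%n+[m/n]*n u D) ⟩
    (x + (w + u / D * D) + (D ∸ w)) % D  ≡⟨ cong (_% D) (rearrange x w (u / D * D) (D ∸ w)) ⟩
    (x + (D ∸ w + w) + u / D * D) % D    ≡⟨ [m+kn]%n≡m%n (x + (D ∸ w + w)) (u / D) D ⟩
    (x + (D ∸ w + w)) % D                ≡⟨ cong (λ v → (x + v) % D) (m∸n+n≡m (m%n≤n u D)) ⟩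
    (x + D) % D                          ≡⟨ [m+n]%n≡m%n x D ⟩
    x % D                                ≡⟨ m<n⇒m%n≡m x<D ⟩
    x                                    ∎
    where
      open ≡-Reasoning
      w : ℕ
      w = u % D
      rearrange : ∀ a b c d → a + (b + c) + d ≡ a + (d + b) + c
      rearrange = solve-∀

  %-absorbʳ : ∀ m n → (m + n % D) % D ≡ (m + n) % D
  %-absorbʳ m n = begin
    (m + n % D) % D  ≡⟨ cong (_% D) (+-comm m (n % D)) ⟩
    (n % D + m) % D  ≡⟨ %-absorbˡ n m ⟩
    (n + m) % D      ≡⟨ cong (_% D) (+-comm n m) ⟩
    (m + n) % D      ∎
    where open ≡-Reasoning

  +-%-cancelʳ : ∀ {x y} u → x < D → y < D → (x + u) % D ≡ (y + u) % D → x ≡ y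
  +-%-cancelʳ {x} {y} u x<D y<D eq = begin
    x                                    ≡⟨ %-+-inverse u x<D ⟨
    ((x + u) % D + (D ∸ u % D)) % D      ≡⟨ cong (λ v → (v + (D ∸ u % D)) % D) eq ⟩
    ((y + u) % D + (D ∸ u % D)) % D      ≡⟨ %-+-inverse u y<D ⟩
    y                                    ∎
    where open ≡-Reasoning

  ℤ-cong⇒%-≡ : ∀ a b k → + a +ℤ k ℤ.* + D ≡ + b → a % D ≡ b % D
  ℤ-cong⇒%-≡ a b (+ k) a+kD≡b = begin
    a % D          ≡⟨ [m+kn]%n≡m%n a k D ⟨
    (a + k * D) % D  ≡⟨ cong (_% D) (ℤ.+-injective lift) ⟩
    b % D          ∎
    where
      open ≡-Reasoning
      lift : + (a + k * D) ≡ + b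
      lift = trans (ℤ.pos-+ a (k * D)) (trans (cong (+ a +ℤ_) (ℤ.pos-* k D)) a+kD≡b)
  ℤ-cong⇒%-≡ a b -[1+ k ] a-kD≡b = begin
    a % D                ≡⟨ cong (_% D) (ℤ.+-injective lift) ⟨
    (b + suc k * D) % D  ≡⟨ [m+kn]%n≡m%n b (suc k) D ⟩
    b % D                ∎
    where
      open ≡-Reasoning
      cancel : ∀ A K E → A +ℤ (ℤ.- K) ℤ.* E +ℤ K ℤ.* E ≡ A
      cancel = ℤ-Solver.solve-∀
      lift : + (b + suc k * D) ≡ + a
      lift = begin
        + (b + suc k * D)                            ≡⟨ ℤ.pos-+ b (suc k * D) ⟩
        + b +ℤ + (suc k * D)                         ≡⟨ cong (+ b +ℤ_) (ℤ.pos-* (suc k) D) ⟩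
        + b +ℤ + suc k ℤ.* + D                       ≡⟨ cong (_+ℤ + suc k ℤ.* + D) a-kD≡b ⟨
        + a +ℤ -[1+ k ] ℤ.* + D +ℤ + suc k ℤ.* + D   ≡⟨ cancel (+ a) (+ suc k) (+ D) ⟩
        + a                                          ∎

  res-+-% : ∀ x w → (res D (+ x - + w) + w) % D ≡ x % D
  res-+-% x w = ℤ-cong⇒%-≡ (e + w) x k (begin
    + (e + w) +ℤ k ℤ.* + D     ≡⟨ cong (_+ℤ k ℤ.* + D) (ℤ.pos-+ e w) ⟩
    + e +ℤ + w +ℤ k ℤ.* + D    ≡⟨ swap (+ e) (+ w) (k ℤ.* + D) ⟩
    + e +ℤ k ℤ.* + D +ℤ + w    ≡⟨ cong (_+ℤ + w) (a≡a%ℕn+[a/ℕn]*n z D) ⟨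
    + x - + w +ℤ + w           ≡⟨ cancel (+ x) (+ w) ⟩
    + x                        ∎)
    where
      open ≡-Reasoning
      z : ℤ
      z = + x - + w
      e : ℕ
      e = res D z
      k : ℤ
      k = z ℤ./ℕ D
      swap : ∀ A B C → A +ℤ B +ℤ C ≡ A +ℤ C +ℤ B
      swap = ℤ-Solver.solve-∀
      cancel : ∀ A B → A - B +ℤ B ≡ A
      cancel = ℤ-Solver.solve-∀

pos-+-∸-rearrange : ∀ {x y a b c w} → x + y ≡ a + b + c + w →
                    + x ≡ + a +ℤ + b +ℤ + c - + y +ℤ + w
pos-+-∸-rearrange {x} {y} {a} {b} {c} {w} x+y≡ = begin
  + x                                    ≡⟨ add-sub (+ x) (+ y) ⟩
  + x +ℤ + y - + y                       ≡⟨ cong (_- + y) (ℤ.pos-+ x y) ⟨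
  + (x + y) - + y                        ≡⟨ cong (λ z → + z - + y) x+y≡ ⟩
  + (a + b + c + w) - + y                ≡⟨ cong (_- + y) pos-+₄ ⟩
  + a +ℤ + b +ℤ + c +ℤ + w - + y         ≡⟨ sub-comm (+ a +ℤ + b +ℤ + c) (+ w) (+ y) ⟩
  + a +ℤ + b +ℤ + c - + y +ℤ + w         ∎
  where
    open ≡-Reasoning
    add-sub : ∀ p q → p ≡ p +ℤ q - q
    add-sub = ℤ-Solver.solve-∀
    sub-comm : ∀ p q r → p +ℤ q - r ≡ p - r +ℤ q
    sub-comm = ℤ-Solver.solve-∀
    pos-+₄ : + (a + b + c + w) ≡ + a +ℤ + b +ℤ + c +ℤ + w
    pos-+₄ = begin
      + (a + b + c + w)             ≡⟨ ℤ.pos-+ (a + b + c) w ⟩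
      + (a + b + c) +ℤ + w          ≡⟨ cong (_+ℤ + w) (ℤ.pos-+ (a + b) c) ⟩
      + (a + b) +ℤ + c +ℤ + w       ≡⟨ cong (λ z → z +ℤ + c +ℤ + w) (ℤ.pos-+ a b) ⟩
      + a +ℤ + b +ℤ + c +ℤ + w      ∎

module _ {D : ℕ} .{{_ : NonZero D}} (1<D : 1 < D) where

  digitSumFuel-zero : ∀ f → digitSumFuel D f 0 ≡ 0
  digitSumFuel-zero zero    = refl
  digitSumFuel-zero (suc f) =
    cong₂ _+_ (n≤0⇒n≡0 (m%n≤m 0 D))
              (trans (cong (digitSumFuel D f) (0/n≡0 D)) (digitSumFuel-zero f))

  m≤1+n⇒m/D≤n : ∀ {n f} → n ≤ suc f → n / D ≤ f
  m≤1+n⇒m/D≤n {zero}  _         = subst (_≤ _) (sym (0/n≡0 D)) z≤n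
  m≤1+n⇒m/D≤n {suc n} (s≤s n≤f) = ≤-trans (≤-pred (m/n<m (suc n) D 1<D)) n≤f

  digitSumFuel-enough : ∀ {f g} n → n ≤ f → n ≤ g → digitSumFuel D f n ≡ digitSumFuel D g n
  digitSumFuel-enough {zero}  {g}     _ z≤n _   = sym (digitSumFuel-zero g)
  digitSumFuel-enough {suc f} {zero}  _ _   z≤n = digitSumFuel-zero (suc f)
  digitSumFuel-enough {suc f} {suc g} n n≤f n≤g =
    cong (_+_ (n % D)) (digitSumFuel-enough (n / D) (m≤1+n⇒m/D≤n n≤f) (m≤1+n⇒m/D≤n n≤g))

  s-unfold : ∀ n → s D n ≡ n % D + s D (n / D)
  s-unfold zero    = sym (cong₂ _+_ (n≤0⇒n≡0 (m%n≤m 0 D)) (cong (s D) (0/n≡0 D)))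
  s-unfold (suc n) =
    cong (_+_ (suc n % D)) (digitSumFuel-enough (suc n / D) (m≤1+n⇒m/D≤n ≤-refl) ≤-refl)

  s-digit : ∀ {i} m → i < D → s D (i + m * D) ≡ i + s D m
  s-digit {i} m i<D = begin
    s D (i + m * D)                                 ≡⟨ s-unfold (i + m * D) ⟩
    (i + m * D) % D + s D ((i + m * D) / D)         ≡⟨ cong₂ (λ x y → x + s D y) last quotient ⟩
    i + s D m                                       ∎
    where
      open ≡-Reasoning
      last : (i + m * D) % D ≡ i
      last = trans ([m+kn]%n≡m%n i m D) (m<n⇒m%n≡m i<D)
      quotient : (i + m * D) / D ≡ m
      quotient = trans (+-distrib-/-∣ʳ i (divides-refl m))
                       (cong₂ _+_ (m<n⇒m/n≡0 i<D) (m*n/n≡m m D))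

module ResidueClass (n j : ℕ) (j<D : j < suc n) where

  D : ℕ
  D = suc n

  complement : ℕ → ℕ
  complement u = res D (+ j - + (u % D))

  complement<D : ∀ u → complement u < D
  complement<D u = n%ℕd<d (+ j - + (u % D)) D

  complement-+ : ∀ u → (complement u + u) % D ≡ j
  complement-+ u = begin
    (complement u + u) % D      ≡⟨ %-absorbʳ (complement u) u ⟨
    (complement u + u % D) % D  ≡⟨ res-+-% j (u % D) ⟩
    j % D                       ≡⟨ m<n⇒m%n≡m j<D ⟩
    j                           ∎
    where open ≡-Reasoning

  complement-unique : ∀ {x} u → x < D → (x + u) % D ≡ j → complement u ≡ x
  complement-unique u x<D x+u≡j = +-%-cancelʳ u (complement<D u) x<D (trans (complement-+ u) (sym x+u≡j))

  complement-shift : ∀ {x i} u m → x < D → x + i ≡ complement u + m * D → complement (i + u) ≡ x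
  complement-shift {x} {i} u m x<D x+i≡c+mD = complement-unique (i + u) x<D (begin
    (x + (i + u)) % D              ≡⟨ cong (_% D) (+-assoc x i u) ⟨
    (x + i + u) % D                ≡⟨ cong (λ y → (y + u) % D) x+i≡c+mD ⟩
    (complement u + m * D + u) % D ≡⟨ cong (_% D) (xy∙z≈xz∙y (complement u) (m * D) u) ⟩
    (complement u + u + m * D) % D ≡⟨ [m+kn]%n≡m%n (complement u + u) m D ⟩
    (complement u + u) % D         ≡⟨ complement-+ u ⟩
    j                              ∎)
    where open ≡-Reasoning

  complement-shift-≤ : ∀ u {i} → i ≤ complement u → complement (i + u) + i ≡ complement u
  complement-shift-≤ u {i} i≤c =
    trans (cong (_+ i) (complement-shift u 0 x<D x+i≡c)) (m∸n+n≡m i≤c)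
    where
      x<D : complement u ∸ i < D
      x<D = ≤-<-trans (m∸n≤m (complement u) i) (complement<D u)
      x+i≡c : complement u ∸ i + i ≡ complement u + 0
      x+i≡c = trans (m∸n+n≡m i≤c) (sym (+-identityʳ (complement u)))

  complement-shift-> : ∀ u {i} → complement u < i → i < D →
                       complement (i + u) + i ≡ complement u + D
  complement-shift-> u {i} c<i i<D = trans (cong (_+ i) (complement-shift u 1 y<D y+i≡c+1*D)) y+i≡c+D
    where
      y : ℕ
      y = complement u + D ∸ i
      y+i≡c+D : y + i ≡ complement u + D
      y+i≡c+D = m∸n+n≡m (≤-trans (<⇒≤ i<D) (m≤n+m D (complement u)))
      y+i≡c+1*D : y + i ≡ complement u + 1 * D
      y+i≡c+1*D = trans y+i≡c+D (cong (_+_ (complement u)) (sym (+-identityʳ D)))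
      y<D : y < D
      y<D = +-cancelʳ-< i y D (subst₂ _<_ (sym y+i≡c+D) (+-comm i D) (+-monoˡ-< D c<i))

  complement-step : ∀ u {r} → suc r < D →
    complement (suc r + u) + suc r + D * (r ∸ complement u) ≡ complement u + D * (suc r ∸ complement u)
  complement-step u {r} r<D with suc r ≤? complement u
  ... | yes r<c = begin
    complement (suc r + u) + suc r + D * (r ∸ c)
      ≡⟨ cong₂ (λ a b → a + D * b) (complement-shift-≤ u r<c) (m≤n⇒m∸n≡0 (<⇒≤ r<c)) ⟩
    c + D * 0
      ≡⟨ cong (λ b → c + D * b) (m≤n⇒m∸n≡0 r<c) ⟨
    c + D * (suc r ∸ c)
      ∎
    where
      open ≡-Reasoning
      c : ℕ
      c = complement u
  ... | no r≮c = begin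
    complement (suc r + u) + suc r + D * (r ∸ c)
      ≡⟨ cong (_+ D * (r ∸ c)) (complement-shift-> u c<1+r r<D) ⟩
    c + D + D * (r ∸ c)
      ≡⟨ +-assoc c D (D * (r ∸ c)) ⟩
    c + (D + D * (r ∸ c))
      ≡⟨ cong (_+_ c) (*-suc D (r ∸ c)) ⟨
    c + D * suc (r ∸ c)
      ≡⟨ cong (λ b → c + D * b) (+-∸-assoc 1 (≤-pred c<1+r)) ⟨
    c + D * (suc r ∸ c)
      ∎
    where
      open ≡-Reasoning
      c : ℕ
      c = complement u
      c<1+r : c < suc r
      c<1+r = ≰⇒> r≮c

  complement-partialSum : ∀ u {r} → r < D →
    sumTo (λ i → complement (i + u)) r + triangle r ≡ complement u * (r + 1) + D * (r ∸ complement u)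
  complement-partialSum u {zero}  _   =
    trans (base (complement u) D) (cong (λ a → complement u * 1 + D * a) (sym (0∸n≡0 (complement u))))
    where
      base : ∀ e D → e + 0 ≡ e * 1 + D * 0
      base = solve-∀
  complement-partialSum u {suc r} r<D = begin
    sumTo f r + x + (triangle r + suc r)
      ≡⟨ interchange (sumTo f r) x (triangle r) (suc r) ⟩
    sumTo f r + triangle r + (x + suc r)
      ≡⟨ cong (_+ (x + suc r)) (complement-partialSum u (<-trans (n<1+n r) r<D)) ⟩
    e * (r + 1) + D * (r ∸ e) + (x + suc r)
      ≡⟨ rearrange (e * (r + 1)) (D * (r ∸ e)) (x + suc r) ⟩
    e * (r + 1) + (x + suc r + D * (r ∸ e))
      ≡⟨ cong (_+_ (e * (r + 1))) (complement-step u r<D) ⟩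
    e * (r + 1) + (e + D * (suc r ∸ e))
      ≡⟨ absorb e r (D * (suc r ∸ e)) ⟩
    e * (suc r + 1) + D * (suc r ∸ e)
      ∎
    where
      open ≡-Reasoning
      f : ℕ → ℕ
      f i = complement (i + u)
      e x : ℕ
      e = complement u
      x = complement (suc r + u)
      rearrange : ∀ a b c → a + b + c ≡ a + (c + b)
      rearrange = solve-∀
      absorb : ∀ e r w → e * (r + 1) + (e + w) ≡ e * (suc r + 1) + w
      absorb = solve-∀

  complement-blockSum : ∀ u → sumTo (λ i → complement (i + u)) n ≡ triangle n
  complement-blockSum u = +-cancelʳ-≡ (triangle n) (sumTo f n) (triangle n) (begin
    sumTo f n + triangle n           ≡⟨ complement-partialSum u ≤-refl ⟩
    e * (n + 1) + D * (n ∸ e)        ≡⟨ cong (λ a → e * a + D * (n ∸ e)) (+-comm n 1) ⟩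
    e * D + D * (n ∸ e)              ≡⟨ cong (_+ D * (n ∸ e)) (*-comm e D) ⟩
    D * e + D * (n ∸ e)              ≡⟨ *-distribˡ-+ D e (n ∸ e) ⟨
    D * (e + (n ∸ e))                ≡⟨ cong (_*_ D) (m+[n∸m]≡n (<⇒≤pred (complement<D u))) ⟩
    suc n * n                        ≡⟨ solve (n ∷ []) ⟩
    n * (n + 1)                      ≡⟨ triangle-*2 n ⟨
    triangle n * 2                   ≡⟨ *-comm (triangle n) 2 ⟩
    triangle n + (triangle n + 0)    ≡⟨ cong (_+_ (triangle n)) (+-identityʳ (triangle n)) ⟩
    triangle n + triangle n          ∎)
    where
      open ≡-Reasoning
      f : ℕ → ℕ
      f i = complement (i + u)
      e : ℕ
      e = complement u

  lastDigit : ℕ → ℕ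
  lastDigit m = complement (s D m)

  enumeration : ℕ → ℕ
  enumeration m = lastDigit m + m * D

  enumeration-strictlyMonotone : StrictlyMonotone enumeration
  enumeration-strictlyMonotone m m′ m<m′ = begin-strict
    lastDigit m + m * D   <⟨ +-monoˡ-< (m * D) (complement<D (s D m)) ⟩
    suc m * D             ≤⟨ *-monoˡ-≤ D m<m′ ⟩
    m′ * D                ≤⟨ m≤n+m (m′ * D) (lastDigit m′) ⟩
    enumeration m′        ∎
    where open ≤-Reasoning

  enumeration-sum : ∀ N → sumTo enumeration N ≡ sumTo lastDigit N + triangle N * D
  enumeration-sum N = trans (sumTo-+ lastDigit (λ m → m * D) N)
                            (cong (_+_ (sumTo lastDigit N)) (sumTo-*ʳ (λ m → m) D N))

  module _ (1<D : 1 < D) where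

    enumeration-isIncreasingEnumeration : IsIncreasingEnumeration (λ k → t D k ≡ j) enumeration
    enumeration-isIncreasingEnumeration = enumeration-strictlyMonotone , satisfies , covers
      where
        satisfies : ∀ m → t D (enumeration m) ≡ j
        satisfies m = trans (cong (_% D) (s-digit 1<D m (complement<D (s D m)))) (complement-+ (s D m))
        covers : ∀ k → t D k ≡ j → ∃[ m ] enumeration m ≡ k
        covers k tk≡j = k / D , (begin
          lastDigit (k / D) + k / D * D  ≡⟨ cong (_+ k / D * D) last-digit ⟩
          k % D + k / D * D              ≡⟨ m≡m%n+[m/n]*n k D ⟨
          k                              ∎)
          where
            open ≡-Reasoning
            last-digit : lastDigit (k / D) ≡ k % D
            last-digit = complement-unique (s D (k / D)) (m%n<n k D)
                           (trans (cong (_% D) (sym (s-unfold 1<D k))) tk≡j)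

    lastDigit-sum : ∀ q {r} → r < D →
      sumTo lastDigit (r + q * D) + triangle r
        ≡ q * triangle n + lastDigit q * (r + 1) + D * (r ∸ lastDigit q)
    lastDigit-sum q {r} r<D = begin
      sumTo lastDigit (r + q * D) + triangle r
        ≡⟨ cong (_+ triangle r) (sumTo-blocks n lastDigit (triangle n) block q r) ⟩
      q * triangle n + sumTo (λ i → lastDigit (i + q * D)) r + triangle r
        ≡⟨ +-assoc (q * triangle n) (sumTo (λ i → lastDigit (i + q * D)) r) (triangle r) ⟩
      q * triangle n + (sumTo (λ i → lastDigit (i + q * D)) r + triangle r)
        ≡⟨ cong (λ x → q * triangle n + (x + triangle r))
                (sumTo-cong-≤ r λ i i≤r → shift q (≤-<-trans i≤r r<D)) ⟩
      q * triangle n + (sumTo (λ i → complement (i + s D q)) r + triangle r)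
        ≡⟨ cong (_+_ (q * triangle n)) (complement-partialSum (s D q) r<D) ⟩
      q * triangle n + (e * (r + 1) + D * (r ∸ e))
        ≡⟨ +-assoc (q * triangle n) (e * (r + 1)) (D * (r ∸ e)) ⟨
      q * triangle n + e * (r + 1) + D * (r ∸ e)
        ∎
      where
        open ≡-Reasoning
        e : ℕ
        e = lastDigit q
        shift : ∀ p {i} → i < D → lastDigit (i + p * D) ≡ complement (i + s D p)
        shift p i<D = cong complement (s-digit 1<D p i<D)
        block : ∀ p → sumTo (λ i → lastDigit (i + p * D)) n ≡ triangle n
        block p = trans (sumTo-cong-≤ n λ i i≤n → shift p (s≤s i≤n)) (complement-blockSum (s D p))

    sumTo-enumeration : ∀ {a} → IsIncreasingEnumeration (λ k → t D k ≡ j) a → ∀ N →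
      let q = N / D
          r = N % D
          e = lastDigit q
      in sumTo a N + triangle r ≡ D * triangle N + q * triangle n + e * (r + 1) + D * (r ∸ e)
    sumTo-enumeration {a} a-enum N = begin
      sumTo a N + triangle r
        ≡⟨ cong (_+ triangle r) (sumTo-cong-≤ N λ m _ → a≗enumeration m) ⟩
      sumTo enumeration N + triangle r
        ≡⟨ cong (_+ triangle r) (enumeration-sum N) ⟩
      sumTo lastDigit N + triangle N * D + triangle r
        ≡⟨ rearrange (sumTo lastDigit N) (triangle N) D (triangle r) ⟩
      D * triangle N + (sumTo lastDigit N + triangle r)
        ≡⟨ cong (λ m → D * triangle N + (sumTo lastDigit m + triangle r)) (m≡m%n+[m/n]*n N D) ⟩
      D * triangle N + (sumTo lastDigit (r + q * D) + triangle r)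
        ≡⟨ cong (_+_ (D * triangle N)) (lastDigit-sum q (m%n<n N D)) ⟩
      D * triangle N + (q * triangle n + e * (r + 1) + D * (r ∸ e))
        ≡⟨ reassociate (D * triangle N) (q * triangle n) (e * (r + 1)) (D * (r ∸ e)) ⟩
      D * triangle N + q * triangle n + e * (r + 1) + D * (r ∸ e)
        ∎
      where
        open ≡-Reasoning
        q r e : ℕ
        q = N / D
        r = N % D
        e = lastDigit q
        a≗enumeration : ∀ m → a m ≡ enumeration m
        a≗enumeration = enumeration-unique a-enum enumeration-isIncreasingEnumeration
        rearrange : ∀ x t d y → x + t * d + y ≡ d * t + (x + y)
        rearrange = solve-∀
        reassociate : ∀ w x y z → w + (x + y + z) ≡ w + x + y + z
        reassociate = solve-∀

    sumTo-enumeration-closedForm : ∀ {a} → IsIncreasingEnumeration (λ k → t D k ≡ j) a → ∀ N →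
      let q = N / D
          r = N % D
          e = lastDigit q
      in sumTo a N + r * (r + 1) / 2 ≡ D * N * (N + 1) / 2 + q * D * n / 2 + e * (r + 1) + D * (r ∸ e)
    sumTo-enumeration-closedForm {a} a-enum N = begin
      sumTo a N + r * (r + 1) / 2
        ≡⟨ cong (_+_ (sumTo a N)) (half-of (triangle r) (sym (triangle-*2 r))) ⟩
      sumTo a N + triangle r
        ≡⟨ sumTo-enumeration a-enum N ⟩
      D * triangle N + q * triangle n + e * (r + 1) + D * (r ∸ e)
        ≡⟨ cong₂ (λ x y → x + y + e * (r + 1) + D * (r ∸ e))
                 (half-of (D * triangle N) full) (half-of (q * triangle n) block) ⟨
      D * N * (N + 1) / 2 + q * D * n / 2 + e * (r + 1) + D * (r ∸ e)
        ∎
      where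
        open ≡-Reasoning
        q r e : ℕ
        q = N / D
        r = N % D
        e = lastDigit q
        full : D * N * (N + 1) ≡ D * triangle N * 2
        full = begin
          D * N * (N + 1)       ≡⟨ *-assoc D N (N + 1) ⟩
          D * (N * (N + 1))     ≡⟨ cong (_*_ D) (triangle-*2 N) ⟨
          D * (triangle N * 2)  ≡⟨ *-assoc D (triangle N) 2 ⟨
          D * triangle N * 2    ∎
        block : q * D * n ≡ q * triangle n * 2
        block = begin
          q * D * n             ≡⟨ *-assoc q D n ⟩
          q * (D * n)           ≡⟨ cong (_*_ q) (*-comm D n) ⟩
          q * (n * D)           ≡⟨ cong (λ x → q * (n * x)) (+-comm 1 n) ⟩
          q * (n * (n + 1))     ≡⟨ cong (_*_ q) (triangle-*2 n) ⟨
          q * (triangle n * 2)  ≡⟨ *-assoc q (triangle n) 2 ⟨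
          q * triangle n * 2    ∎

theorem3p2 : (d : ℕ) .{{_ : NonZero d}} → 2 ≤ d → (j : ℕ) → j < d →
    (a : ℕ → ℕ) → IsIncreasingEnumeration (λ k → t d k ≡ j) a →
    (N : ℕ) →
    let q = N / d
        r = N % d
        e = res d (+ j - + (t d q))
    in + (sumTo a N) ≡
         + ((d * N * (N + 1)) / 2)
         +ℤ + ((q * d * (d ∸ 1)) / 2)
         +ℤ + (e * (r + 1))
         - + ((r * (r + 1)) / 2)
         +ℤ + (d * (r ∸ e))
theorem3p2 (suc n) 2≤d j j<d a a-enum N =
  pos-+-∸-rearrange {a = suc n * N * (N + 1) / 2} {b = q * suc n * n / 2} {c = e * (r + 1)}
    (sumTo-enumeration-closedForm 2≤d a-enum N)
  where
    open ResidueClass n j j<d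
    q r e : ℕ
    q = N / D
    r = N % D
    e = lastDigit q
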